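{- Let $\mathcal{Z}$ be a zero-set and let $(\vec r,\vec c)$ be enhancements that span for $\mathcal{Z}$; let $A_t=\mathcal{T}_{\mathrm{en}}^t(\emptyset)$. Let $I_0,I_1,\dots,I_M$ be the maximal intervals of $\mathbb{Z}_+$ on which $i\mapsto c_i$ is constant, listed from left to right, and let $J_0,J_1,\dots,J_N$ be the maximal intervals of $\mathbb{Z}_+$ on which $j\mapsto r_j$ is constant, listed from bottom to top. Then $\bigcup_{i+j<t}I_i\times J_j\subseteq A_t$ for all $t\ge0$.
   Context: $\mathbb{Z}_+=\{0,1,2,\dots\}$, $\mathbb{N}=\{1,2,\dots\}$. For $a,b\in\mathbb{N}$, $R_{a,b}=([0,a-1]\times[0,b-1])\cap\mathbb{Z}_+^2$; a zero-set is a union of $R_{a,b}$ over a finite $\mathcal{I}\subseteq\mathbb{N}^2$. For $x\in\mathbb{Z}_+^2$ and $A\subseteq\mathbb{Z}_+^2$, $\mathtt{row}(x,A)$ and $\mathtt{col}(x,A)$ are the numbers of points of $A$ on the horizontal and vertical line through $x$. Enhancements $\vec r=(r_0,r_1,\dots)$, $\vec c=(c_0,c_1,\dots)$ are weakly decreasing sequences of nonnegative integers with finite support; $\mathcal{T}_{\mathrm{en}}(A)=A\cup\{(i,j)\in\mathbb{Z}_+^2:(\mathtt{row}((i,j),A)+r_j,\mathtt{col}((i,j),A)+c_i)\notin\mathcal{Z}\}$; $(\vec r,\vec c)$ spans for $\mathcal{Z}$ if $\bigcup_{t\ge0}\mathcal{T}_{\mathrm{en}}^t(\emptyset)=\mathbb{Z}_+^2$.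 (Here $c_i$ is the length of column $i$ of the Young diagram associated to $\vec c$ and $r_j$ the length of row $j$ of that associated to $\vec r$.) -}

module Defs where

open import Data.Nat using (ℕ; zero; suc; _+_; _∸_; _≤_; _<_)
open import Data.Nat.Properties using (_≟_)
open import Data.Product using (Σ; _×_; _,_; ∃)
open import Data.Sum using (_⊎_)
open import Data.Empty using (⊥)
open import Data.List using (List; length)
open import Data.List.Relation.Unary.All using (All)
open import Data.List.Relation.Unary.Any using (Any)
open import Data.List.Relation.Unary.Unique.Propositional using (Unique)
open import Data.List.Membership.Propositional using (_∈_)
open import Relation.Binary.PropositionalEquality using (_≡_)
open import Relation.Nullary using (yes; no)

-- Subsets of ℤ₊² as predicates: A i j means (i , j) ∈ A.
Subset² : Set₁
Subset² = ℕ → ℕ → Set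

-- A finite index set 𝓘 ⊆ ℕ² (ℕ = {1,2,...}) given as a list of pairs (a , b).
PositivePairs : List (ℕ × ℕ) → Set
PositivePairs 𝓘 = All (λ ab → 1 ≤ Data.Product.proj₁ ab × 1 ≤ Data.Product.proj₂ ab) 𝓘

-- The zero-set 𝓩 = ⋃_{(a,b) ∈ 𝓘} R_{a,b}, R_{a,b} = [0,a-1] × [0,b-1].
_∈𝓩[_] : ℕ × ℕ → List (ℕ × ℕ) → Set
(x , y) ∈𝓩[ 𝓘 ] = Any (λ ab → x < Data.Product.proj₁ ab × y < Data.Product.proj₂ ab) 𝓘

record Enhancement : Set where
  field
    seq        : ℕ → ℕ
    decreasing : ∀ m n → m ≤ n → seq n ≤ seq m
    finiteSupp : ∃ λ K → ∀ n → K ≤ n → seq n ≡ 0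
open Enhancement public

AtLeast : ℕ → (ℕ → Set) → Set
AtLeast k P = Σ (List ℕ) λ xs → length xs ≡ k × Unique xs × All P xs

RowAtLeast : Subset² → ℕ → ℕ → Set
RowAtLeast A j k = AtLeast k (λ i' → A i' j)

ColAtLeast : Subset² → ℕ → ℕ → Set
ColAtLeast A i k = AtLeast k (λ j' → A i j')

-- (row((i,j),A) + r_j , col((i,j),A) + c_i) ∉ 𝓩, unfolded:
-- for every rectangle R_{a,b} of 𝓘, row + r_j ≥ a or col + c_i ≥ b,
-- i.e. row ≥ a ∸ r_j or col ≥ b ∸ c_i.
-- (Counts may be infinite, so "row ≥ k" is expressed by AtLeast.)
NotInZ : List (ℕ × ℕ) → Enhancement → Enhancement → Subset² → ℕ → ℕ → Set
NotInZ 𝓘 r c A i j =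
  All (λ ab → RowAtLeast A j (Data.Product.proj₁ ab ∸ seq r j)
            ⊎ ColAtLeast A i (Data.Product.proj₂ ab ∸ seq c i)) 𝓘

Ten : List (ℕ × ℕ) → Enhancement → Enhancement → Subset² → Subset²
Ten 𝓘 r c A i j = A i j ⊎ NotInZ 𝓘 r c A i j

Aₜ : List (ℕ × ℕ) → Enhancement → Enhancement → ℕ → Subset²
Aₜ 𝓘 r c zero    i j = ⊥
Aₜ 𝓘 r c (suc t) i j = Ten 𝓘 r c (Aₜ 𝓘 r c t) i j

Spans : List (ℕ × ℕ) → Enhancement → Enhancement → Set
Spans 𝓘 r c = ∀ i j → ∃ λ t → Aₜ 𝓘 r c t i j

-- Index of the maximal interval of constancy of f containing n, intervals
-- numbered 0,1,2,... from left to right: the number of k < n with f (k+1) ≠ f k.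
blockIndex : (ℕ → ℕ) → ℕ → ℕ
blockIndex f zero = zero
blockIndex f (suc n) with f (suc n) ≟ f n
... | yes _ = blockIndex f n
... | no  _ = suc (blockIndex f n)

InBlock : (ℕ → ℕ) → ℕ → ℕ → Set
InBlock f p n = blockIndex f n ≡ p

module Submission where

-- Write p(i) and q(j) for the indices of the constancy blocks of
-- c and r containing column i and row j.  We show by induction on t that
-- every (i , j) with p(i) + q(j) < t lies in A_t.  For the step, put B = A_t;
-- by induction B already contains the points of row j left of block p(i) and
-- the points of column i below block q(j).  Since the enhancements span,
-- (i , j) itself lies in some A_s, and we follow how points of the "block
-- quadrant" {(i', j') : p(i) ≤ p(i'), q(j) ≤ q(j')} enter the A_s: a point of
-- the quadrant is added to A_{s+1} because its row or column has enough
-- points of A_s; each of those points is either in the quadrant again (and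
-- then, by induction on s, we are done) or is a point of B on row j resp.
-- column i.  As r and c are constant on blocks and decreasing, r_{j'} ≤ r_j and
-- c_{i'} ≤ c_i, so B's counts at (i , j) meet the same thresholds, i.e. the
-- transformation adds (i , j) to A_{t+1}.

open import Defs
open import Data.Nat using (ℕ; zero; suc; _+_; _<_; _≤_; _∸_; _≤′_; ≤′-refl; ≤′-step; s≤s)
open import Data.Nat.Properties
open import Data.Product using (_×_; _,_; proj₁; proj₂)
open import Data.Sum using (_⊎_; inj₁; inj₂; [_,_])
import Data.Sum as Sum
open import Data.Empty using (⊥-elim)
open import Data.List using (List; length; drop)
open import Data.List.Properties using (length-drop)
open import Data.List.Relation.Unary.All using (All; []; _∷_)
import Data.List.Relation.Unary.All.Properties as All
import Data.List.Relation.Unary.Unique.Propositional.Properties as Unique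
open import Function using (id; _∘_)
open import Relation.Binary.PropositionalEquality using (_≡_; refl; sym; trans; subst)
open import Relation.Nullary using (yes; no)

blockIndex-step : ∀ f n →
  (f (suc n) ≡ f n × blockIndex f (suc n) ≡ blockIndex f n)
  ⊎ blockIndex f (suc n) ≡ suc (blockIndex f n)
blockIndex-step f n with f (suc n) ≟ f n
... | yes f-same = inj₁ (f-same , refl)
... | no  _      = inj₂ refl

blockIndex-mono : ∀ f {m n} → m ≤′ n → blockIndex f m ≤ blockIndex f n
blockIndex-mono f ≤′-refl = ≤-refl
blockIndex-mono f {m} {suc n} (≤′-step m≤n) with blockIndex-step f n
... | inj₁ (_ , same) rewrite same = blockIndex-mono f m≤n
... | inj₂ new        rewrite new  = m≤n⇒m≤1+n (blockIndex-mono f m≤n)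

blockIndex-const : ∀ f {m n} → m ≤′ n → blockIndex f m ≡ blockIndex f n → f m ≡ f n
blockIndex-const f ≤′-refl _ = refl
blockIndex-const f {m} {suc n} (≤′-step m≤n) sameBlock with blockIndex-step f n
... | inj₁ (f-same , same) = trans (blockIndex-const f m≤n (trans sameBlock same)) (sym f-same)
... | inj₂ new = ⊥-elim (1+n≰n (begin-strict
      blockIndex f n         <⟨ n<1+n _ ⟩
      suc (blockIndex f n)   ≡⟨ sym new ⟩
      blockIndex f (suc n)   ≡⟨ sym sameBlock ⟩
      blockIndex f m         ≤⟨ blockIndex-mono f m≤n ⟩
      blockIndex f n         ∎))
  where open ≤-Reasoning

-- An enhancement can only decrease from one block to a later one; this is
-- what lets a point of a later block be compared with (i , j).
seq-antitone-blocks : (e : Enhancement) → ∀ {m n} →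
  blockIndex (seq e) m ≤ blockIndex (seq e) n → seq e n ≤ seq e m
seq-antitone-blocks e {m} {n} blocks≤ with ≤-total m n
... | inj₁ m≤n = decreasing e m n m≤n
... | inj₂ n≤m = ≤-reflexive (blockIndex-const (seq e) (≤⇒≤′ n≤m)
                   (≤-antisym (blockIndex-mono (seq e) (≤⇒≤′ n≤m)) blocks≤))

AtLeast-weaken : ∀ {P : ℕ → Set} {k k'} → k' ≤ k → AtLeast k P → AtLeast k' P
AtLeast-weaken {k = k} {k'} k'≤k (xs , length≡k , unique , all) =
  drop (k ∸ k') xs , length-rest , Unique.drop⁺ (k ∸ k') unique , All.drop⁺ (k ∸ k') all
  where
  length-rest : length (drop (k ∸ k') xs) ≡ k'
  length-rest = trans (length-drop (k ∸ k') xs)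
    (subst (λ l → l ∸ (k ∸ k') ≡ k') (sym length≡k) (m∸[m∸n]≡n k'≤k))

All-escape : ∀ {X G : Set} {P Q : X → Set} {xs} →
  (∀ {x} → P x → G ⊎ Q x) → All P xs → G ⊎ All Q xs
All-escape f [] = inj₂ []
All-escape f (px ∷ pxs) with f px | All-escape f pxs
... | inj₁ g  | _         = inj₁ g
... | inj₂ _  | inj₁ g    = inj₁ g
... | inj₂ qx | inj₂ qxs  = inj₂ (qx ∷ qxs)

AtLeast-escape : ∀ {G : Set} {P Q : ℕ → Set} {k} →
  (∀ {x} → P x → G ⊎ Q x) → AtLeast k P → G ⊎ AtLeast k Q
AtLeast-escape f (xs , length≡k , unique , all) =
  Sum.map₂ (λ allQ → xs , length≡k , unique , allQ) (All-escape f all)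

NotInZ-transfer : ∀ 𝓘 r c {A B : Subset²} {G : Set} {i j i' j'} →
  seq r j' ≤ seq r j → seq c i' ≤ seq c i →
  (∀ {x} → A x j' → G ⊎ B x j) → (∀ {y} → A i' y → G ⊎ B i y) →
  NotInZ 𝓘 r c A i' j' → G ⊎ NotInZ 𝓘 r c B i j
NotInZ-transfer 𝓘 r c {A} {B} {G} {i} {j} {i'} {j'} r≤ c≤ row col = All-escape rectangle
  where
  rectangle : ∀ {ab : ℕ × ℕ} →
    RowAtLeast A j' (proj₁ ab ∸ seq r j') ⊎ ColAtLeast A i' (proj₂ ab ∸ seq c i') →
    G ⊎ (RowAtLeast B j (proj₁ ab ∸ seq r j) ⊎ ColAtLeast B i (proj₂ ab ∸ seq c i))
  rectangle {a , _} (inj₁ rowA) =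
    Sum.map₂ (inj₁ ∘ AtLeast-weaken (∸-monoʳ-≤ a r≤)) (AtLeast-escape row rowA)
  rectangle {_ , b} (inj₂ colA) =
    Sum.map₂ (inj₂ ∘ AtLeast-weaken (∸-monoʳ-≤ b c≤)) (AtLeast-escape col colA)

module _ (𝓘 : List (ℕ × ℕ)) (r c : Enhancement) where

  colBlock rowBlock : ℕ → ℕ
  colBlock = blockIndex (seq c)
  rowBlock = blockIndex (seq r)

  quadrant-growth : (B : Subset²) → ∀ i j →
    (∀ x → colBlock x < colBlock i → B x j) →
    (∀ y → rowBlock y < rowBlock j → B i y) →
    ∀ s i' j' → colBlock i ≤ colBlock i' → rowBlock j ≤ rowBlock j' →
    Aₜ 𝓘 r c s i' j' → NotInZ 𝓘 r c B i j
  quadrant-growth B i j rowB colB zero i' j' p≤ q≤ ()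
  quadrant-growth B i j rowB colB (suc s) i' j' p≤ q≤ (inj₁ earlier) =
    quadrant-growth B i j rowB colB s i' j' p≤ q≤ earlier
  quadrant-growth B i j rowB colB (suc s) i' j' p≤ q≤ (inj₂ grown) =
    [ id , id ] (NotInZ-transfer 𝓘 r c (seq-antitone-blocks r q≤) (seq-antitone-blocks c p≤)
                  row col grown)
    where
    row : ∀ {x} → Aₜ 𝓘 r c s x j' → NotInZ 𝓘 r c B i j ⊎ B x j
    row {x} inA with colBlock x <? colBlock i
    ... | yes left = inj₂ (rowB x left)
    ... | no ¬left = inj₁ (quadrant-growth B i j rowB colB s x j' (≮⇒≥ ¬left) q≤ inA)
    col : ∀ {y} → Aₜ 𝓘 r c s i' y → NotInZ 𝓘 r c B i j ⊎ B i y
    col {y} inA with rowBlock y <? rowBlock j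
    ... | yes below = inj₂ (colB y below)
    ... | no ¬below = inj₁ (quadrant-growth B i j rowB colB s i' y p≤ (≮⇒≥ ¬below) inA)

  blocks-filled : Spans 𝓘 r c → ∀ t i j → colBlock i + rowBlock j < t → Aₜ 𝓘 r c t i j
  blocks-filled spans zero i j ()
  blocks-filled spans (suc t) i j (s≤s p+q≤t) =
    inj₂ (quadrant-growth (Aₜ 𝓘 r c t) i j rowFilled colFilled
            (proj₁ (spans i j)) i j ≤-refl ≤-refl (proj₂ (spans i j)))
    where
    rowFilled : ∀ x → colBlock x < colBlock i → Aₜ 𝓘 r c t x j
    rowFilled x left = blocks-filled spans t x j
      (<-≤-trans (+-monoˡ-< (rowBlock j) left) p+q≤t)
    colFilled : ∀ y → rowBlock y < rowBlock j → Aₜ 𝓘 r c t i y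
    colFilled y below = blocks-filled spans t i y
      (<-≤-trans (+-monoʳ-< (colBlock i) below) p+q≤t)

lemma2p4 : (𝓘 : List (ℕ × ℕ)) → PositivePairs 𝓘 → (r c : Enhancement) →
    Spans 𝓘 r c →
    ∀ (t p q i j : ℕ) → p + q < t → InBlock (seq c) p i → InBlock (seq r) q j →
    Aₜ 𝓘 r c t i j
lemma2p4 𝓘 _ r c spans t p q i j p+q<t refl refl = blocks-filled 𝓘 r c spans t i j p+q<t
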